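{- Let $G$ be a graph and let $\psi$ be a minimal b-coloring of $G$ with $k$ colors, where $k\ge\chi(G)+1$. If $x\in V(G)\setminus\mathcal{B}(\psi)$ is mutable and $|\psi(U(x))|=1$, then $G$ has a b-coloring with $k-1$ colors.
   Context: A coloring of $G$ with $k$ colors is a map $\psi:V(G)\to\{1,\dots,k\}$ with adjacent vertices receiving different colors; for $X\subseteq V(G)$, $\psi(X)=\{\psi(v):v\in X\}$. A vertex $u$ is a b-vertex of $\psi$ if for every color $c\ne\psi(u)$ some neighbor of $u$ has color $c$; $\mathcal{B}(\psi)$ is the set of b-vertices of $\psi$. A b-coloring with $k$ colors is a coloring with $k$ colors in which each of the $k$ color classes is nonempty and contains a b-vertex. A b-coloring $\psi$ with $k$ colors is minimal if $|\mathcal{B}(\psi)|$ is minimum among all b-colorings of $G$ with $k$ colors. For $x\in V(G)\setminus\mathcal{B}(\psi)$, $U(x)=\{w\in\mathcal{B}(\psi): \psi^{ -1}(\psi(x))\cap N(w)=\{x\}\}$. A vertex $x\in V(G)\setminus\mathcal{B}(\psi)$ is mutable if there is a color $i\in\{1,\dots,k\}\setminus\psi(N[x])$ such that $\{1,\dots,k\}\setminus\psi(N[w]\setminus\{x\})\neq\{i\}$ for every $w\in N(x)\setminus\mathcal{B}(\psi)$. -}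

module Defs where

open import Data.Nat using (ℕ; zero; suc; _≤_; _<_)
open import Data.Fin using (Fin)
open import Data.Fin.Properties using (all?; any?; _≟_)
open import Data.List using (List; length; filter)
open import Data.List using () renaming (map to lmap)
open import Data.Vec.Functional using ()
open import Data.Fin using () renaming (zero to fz)
open import Data.Product using (Σ; ∃; ∃-syntax; _×_; _,_)
open import Data.Sum using (_⊎_)
open import Relation.Nullary using (¬_; Dec; yes; no)
open import Relation.Nullary.Decidable using (_×-dec_; ¬?; _→-dec_)
open import Relation.Binary.PropositionalEquality using (_≡_; _≢_)
open import Data.List using (allFin)

record Graph : Set₁ where
  field
    n      : ℕ
    Adj    : Fin n → Fin n → Set
    adj?   : ∀ u v → Dec (Adj u v)
    sym    : ∀ {u v} → Adj u v → Adj v u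
    irrefl : ∀ {u} → ¬ Adj u u

module _ (G : Graph) where
  open Graph G

  Vertex : Set
  Vertex = Fin n

  IsColoring : (k : ℕ) → (Vertex → Fin k) → Set
  IsColoring k ψ = ∀ u v → Adj u v → ψ u ≢ ψ v

  IsChromaticNumber : ℕ → Set
  IsChromaticNumber χ =
    (Σ (Vertex → Fin χ) (IsColoring χ)) ×
    (∀ m → m < χ → ¬ Σ (Vertex → Fin m) (IsColoring m))

  IsBVertex : {k : ℕ} → (Vertex → Fin k) → Vertex → Set
  IsBVertex {k} ψ u = ∀ (c : Fin k) → c ≢ ψ u → ∃[ w ] (Adj u w × ψ w ≡ c)

  isBVertex? : {k : ℕ} → (ψ : Vertex → Fin k) → ∀ u → Dec (IsBVertex ψ u)
  isBVertex? ψ u = all? λ c → ¬? (c ≟ ψ u) →-dec any? (λ w → adj? u w ×-dec (ψ w ≟ c))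

  numBVertices : {k : ℕ} → (Vertex → Fin k) → ℕ
  numBVertices ψ = length (filter (isBVertex? ψ) (allFin n))

  IsBColoring : (k : ℕ) → (Vertex → Fin k) → Set
  IsBColoring k ψ = IsColoring k ψ ×
    (∀ (c : Fin k) → (∃[ v ] ψ v ≡ c) × (∃[ u ] (ψ u ≡ c × IsBVertex ψ u)))

  IsMinimalBColoring : (k : ℕ) → (Vertex → Fin k) → Set
  IsMinimalBColoring k ψ = IsBColoring k ψ ×
    (∀ (φ : Vertex → Fin k) → IsBColoring k φ → numBVertices ψ ≤ numBVertices φ)

  InU : {k : ℕ} → (Vertex → Fin k) → Vertex → Vertex → Set
  InU ψ x w = IsBVertex ψ w × Adj w x × (∀ y → Adj w y → ψ y ≡ ψ x → y ≡ x)

  ImageUSizeOne : {k : ℕ} → (Vertex → Fin k) → Vertex → Set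
  ImageUSizeOne {k} ψ x = ∃[ c ] ((∃[ w ] (InU ψ x w × ψ w ≡ c)) × (∀ w → InU ψ x w → ψ w ≡ c))

  InImageClosedNbhdMinus : {k : ℕ} → (Vertex → Fin k) → Vertex → Vertex → Fin k → Set
  InImageClosedNbhdMinus ψ w x c = ∃[ v ] (((v ≡ w) ⊎ Adj w v) × v ≢ x × ψ v ≡ c)

  IsMutable : {k : ℕ} → (Vertex → Fin k) → Vertex → Set
  IsMutable {k} ψ x = ¬ IsBVertex ψ x ×
    ∃[ i ] (
             (i ≢ ψ x × (∀ y → Adj x y → ψ y ≢ i)) ×
             -- for all w ∈ N(x) ∖ B(ψ): {1..k} ∖ ψ(N[w]∖{x}) ≠ {i}
             (∀ w → Adj x w → ¬ IsBVertex ψ w →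
                ¬ (∀ (c : Fin k) → (¬ InImageClosedNbhdMinus ψ w x c → c ≡ i)
                                 × (c ≡ i → ¬ InImageClosedNbhdMinus ψ w x c))))

-- Recoloring the mutable vertex x with a color i missing from N[x] gives a proper coloring ψ′.
-- Every b-vertex of ψ′ is one of ψ (at a non-b-vertex neighbor w of x this is exactly what
-- mutability forbids: w would miss only i in ψ(N[w] ∖ {x})), every b-vertex of ψ outside U(x)
-- survives, and the vertices of U(x) ≠ ∅ do not. So ψ′ has fewer b-vertices than ψ, and by
-- minimality it is not a b-coloring; as U(x) has the single color c, only the class c of ψ′ lacks
-- a b-vertex. Giving each vertex of that class a color missing from its neighborhood dissolves
-- the class and leaves a b-coloring with k − 1 colors.
module Submission where

open import Defs
open import Data.Nat using (ℕ; suc; zero; _≤_; _∸_; _<_; s≤s; z≤n)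
open import Data.Nat.Properties using (m≤n⇒m≤1+n; <⇒≱)
open import Data.Fin using (Fin; punchIn; punchOut)
open import Data.Fin.Properties
  using (_≟_; ¬∀⟶∃¬; any?; punchInᵢ≢i; punchIn-injective; punchIn-punchOut; punchOut-injective)
open import Data.Vec.Functional using (updateAt)
open import Data.Vec.Functional.Properties using (updateAt-updates; updateAt-minimal)
open import Data.Product using (Σ; ∃-syntax; _×_; _,_; proj₁; proj₂)
open import Data.Sum using (inj₁; inj₂)
open import Data.Empty using (⊥-elim)
open import Function using (const)
open import Relation.Nullary using (¬_; Dec; yes; no)
open import Relation.Nullary.Decidable using (_×-dec_; ¬?; _→-dec_)
open import Relation.Binary.PropositionalEquality using (_≡_; _≢_; refl; sym; trans; subst)
open import Data.List using ([]; _∷_; length; filter)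
open import Data.List.Membership.Propositional using (_∈_)
open import Data.List.Membership.Propositional.Properties using (∈-allFin)
open import Data.List.Relation.Unary.Any using (here; there)
open import Relation.Unary using (Pred; Decidable; _⊆_)

module _ {a p q} {A : Set a} {P : Pred A p} {Q : Pred A q}
         (P? : Decidable P) (Q? : Decidable Q) (P⊆Q : P ⊆ Q) where

  length-filter-mono : ∀ xs → length (filter P? xs) ≤ length (filter Q? xs)
  length-filter-mono [] = z≤n
  length-filter-mono (y ∷ xs) with P? y | Q? y
  ... | yes _  | yes _  = s≤s (length-filter-mono xs)
  ... | yes py | no ¬qy = ⊥-elim (¬qy (P⊆Q py))
  ... | no _   | yes _  = m≤n⇒m≤1+n (length-filter-mono xs)
  ... | no _   | no _   = length-filter-mono xs

  length-filter-strictMono : ∀ {xs y} → y ∈ xs → Q y → ¬ P y →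
                             length (filter P? xs) < length (filter Q? xs)
  length-filter-strictMono {z ∷ xs} (here refl) qz ¬pz with P? z | Q? z
  ... | yes pz | _      = ⊥-elim (¬pz pz)
  ... | no _   | yes _  = s≤s (length-filter-mono xs)
  ... | no _   | no ¬qz = ⊥-elim (¬qz qz)
  length-filter-strictMono {z ∷ xs} (there y∈xs) qy ¬py with P? z | Q? z
  ... | yes _  | yes _  = s≤s (length-filter-strictMono y∈xs qy ¬py)
  ... | yes pz | no ¬qz = ⊥-elim (¬qz (P⊆Q pz))
  ... | no _   | yes _  = m≤n⇒m≤1+n (length-filter-strictMono y∈xs qy ¬py)
  ... | no _   | no _   = length-filter-strictMono y∈xs qy ¬py

module _ (G : Graph) where
  open Graph G renaming (sym to Adj-sym)

  private
    V : Set
    V = Vertex G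

  Adj⇒≢ : ∀ {u v} → Adj u v → u ≢ v
  Adj⇒≢ a refl = irrefl a

  ¬IsBVertex⇒missingColor : ∀ {k} (ψ : V → Fin k) {u} → ¬ IsBVertex G ψ u →
                            ∃[ d ] (d ≢ ψ u × (∀ w → Adj u w → ψ w ≢ d))
  ¬IsBVertex⇒missingColor {k} ψ {u} u∉B
    with ¬∀⟶∃¬ k _ (λ d → ¬? (d ≟ ψ u) →-dec any? (λ w → adj? u w ×-dec (ψ w ≟ d))) u∉B
  ... | d , ¬seen = d , (λ d≡ψu → ¬seen (λ d≢ψu → ⊥-elim (d≢ψu d≡ψu)))
                      , (λ w a ψw≡d → ¬seen (λ _ → w , a , ψw≡d))

  numBVertices-< : ∀ {k} {φ ψ : V → Fin k} → IsBVertex G φ ⊆ IsBVertex G ψ →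
                   ∀ w → IsBVertex G ψ w → ¬ IsBVertex G φ w → numBVertices G φ < numBVertices G ψ
  numBVertices-< B⊆B w w∈B w∉B =
    length-filter-strictMono (isBVertex? G _) (isBVertex? G _) B⊆B (∈-allFin w) w∈B w∉B

  IsBColoring-intro : ∀ {k} {ψ : V → Fin k} → IsColoring G k ψ →
                      (∀ d → ∃[ u ] (ψ u ≡ d × IsBVertex G ψ u)) → IsBColoring G k ψ
  IsBColoring-intro proper bVertexOf = proper , λ d →
    let u , ψu≡d , u∈B = bVertexOf d in (u , ψu≡d) , (u , ψu≡d , u∈B)

  module _ {k} (ψ : V → Fin (suc k)) (c : Fin (suc k)) (proper : IsColoring G (suc k) ψ)
           (class-c-∉B : ∀ v → ψ v ≡ c → ¬ IsBVertex G ψ v) where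

    private
      recolor : ∀ v → Dec (ψ v ≡ c) → Fin (suc k)
      recolor v (yes ψv≡c) = proj₁ (¬IsBVertex⇒missingColor ψ (class-c-∉B v ψv≡c))
      recolor v (no _)     = ψ v

      ψ̃ : V → Fin (suc k)
      ψ̃ v = recolor v (ψ v ≟ c)

      ψ̃-avoids : ∀ v → c ≢ ψ̃ v
      ψ̃-avoids v with ψ v ≟ c
      ... | no ψv≢c = λ c≡ψv → ψv≢c (sym c≡ψv)
      ... | yes ψv≡c = λ c≡d →
        proj₁ (proj₂ (¬IsBVertex⇒missingColor ψ (class-c-∉B v ψv≡c))) (trans (sym c≡d) (sym ψv≡c))

      ψ̃-keeps : ∀ {v} → ψ v ≢ c → ψ̃ v ≡ ψ v
      ψ̃-keeps {v} ψv≢c with ψ v ≟ c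
      ... | yes ψv≡c = ⊥-elim (ψv≢c ψv≡c)
      ... | no _     = refl

      ψ̃-missing : ∀ {v} → ψ v ≡ c → ∀ w → Adj v w → ψ w ≢ ψ̃ v
      ψ̃-missing {v} ψv≡c with ψ v ≟ c
      ... | no ψv≢c = ⊥-elim (ψv≢c ψv≡c)
      ... | yes ψv≡c′ = proj₂ (proj₂ (¬IsBVertex⇒missingColor ψ (class-c-∉B v ψv≡c′)))

      ψ̃-proper : IsColoring G (suc k) ψ̃
      ψ̃-proper u v a = byClass (ψ u ≟ c) (ψ v ≟ c)
        where
          byClass : Dec (ψ u ≡ c) → Dec (ψ v ≡ c) → ψ̃ u ≢ ψ̃ v
          byClass (yes ψu≡c) (yes ψv≡c) = ⊥-elim (proper u v a (trans ψu≡c (sym ψv≡c)))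
          byClass (yes ψu≡c) (no ψv≢c)  = λ eq →
            ψ̃-missing ψu≡c v a (trans (sym (ψ̃-keeps ψv≢c)) (sym eq))
          byClass (no ψu≢c)  (yes ψv≡c) = λ eq →
            ψ̃-missing ψv≡c u (Adj-sym a) (trans (sym (ψ̃-keeps ψu≢c)) eq)
          byClass (no ψu≢c)  (no ψv≢c)  = λ eq →
            proper u v a (trans (sym (ψ̃-keeps ψu≢c)) (trans eq (ψ̃-keeps ψv≢c)))

      φ : V → Fin k
      φ v = punchOut (ψ̃-avoids v)

      φ-proper : IsColoring G k φ
      φ-proper u v a eq = ψ̃-proper u v a (punchOut-injective (ψ̃-avoids u) (ψ̃-avoids v) eq)

      φ-from-ψ̃ : ∀ {v f} → ψ̃ v ≡ punchIn c f → φ v ≡ f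
      φ-from-ψ̃ {v} {f} eq = punchIn-injective c (φ v) f (trans (punchIn-punchOut (ψ̃-avoids v)) eq)

      φ-from-ψ : ∀ {v f} → ψ v ≡ punchIn c f → φ v ≡ f
      φ-from-ψ {f = f} eq =
        φ-from-ψ̃ (trans (ψ̃-keeps (λ ψv≡c → punchInᵢ≢i c f (trans (sym eq) ψv≡c))) eq)

      φ-BVertex : ∀ {u} → IsBVertex G ψ u → IsBVertex G φ u
      φ-BVertex u∈B f f≢φu =
        let w , a , ψw≡ = u∈B (punchIn c f) λ eq → f≢φu (sym (φ-from-ψ (sym eq)))
        in w , a , φ-from-ψ ψw≡

    bColoring-dissolveClass : (∀ d → d ≢ c → ∃[ u ] (ψ u ≡ d × IsBVertex G ψ u)) →
                              Σ (V → Fin k) (IsBColoring G k)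
    bColoring-dissolveClass bVertexOf = φ , IsBColoring-intro φ-proper λ f →
      let u , ψu≡ , u∈B = bVertexOf (punchIn c f) (punchInᵢ≢i c f)
      in u , φ-from-ψ ψu≡ , φ-BVertex u∈B

  OnlyMissingColor : ∀ {k} → (V → Fin k) → V → V → Fin k → Set
  OnlyMissingColor {k} ψ w x i = ∀ (c : Fin k) → (¬ InImageClosedNbhdMinus G ψ w x c → c ≡ i)
                                               × (c ≡ i → ¬ InImageClosedNbhdMinus G ψ w x c)

  module Recolor {k} (ψ : V → Fin k) (proper : IsColoring G k ψ) (x : V) (i : Fin k)
                 (i∉ψNx : ∀ y → Adj x y → ψ y ≢ i) (i≢ψx : i ≢ ψ x) where

    ψ′ : V → Fin k
    ψ′ = updateAt ψ x (const i)

    ψ′-x : ψ′ x ≡ i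
    ψ′-x = updateAt-updates x ψ

    ψ′-elsewhere : ∀ {v} → v ≢ x → ψ′ v ≡ ψ v
    ψ′-elsewhere {v} v≢x = updateAt-minimal v x ψ v≢x

    ψ′-≢i : ∀ {v d} → ψ′ v ≡ d → d ≢ i → v ≢ x × ψ v ≡ d
    ψ′-≢i {v} {d} ψ′v≡d d≢i with v ≟ x
    ... | yes refl = ⊥-elim (d≢i (trans (sym ψ′v≡d) ψ′-x))
    ... | no v≢x   = v≢x , trans (sym (ψ′-elsewhere v≢x)) ψ′v≡d

    ψ′-proper : IsColoring G k ψ′
    ψ′-proper u v a with u ≟ x | v ≟ x
    ... | yes refl | yes refl = ⊥-elim (irrefl a)
    ... | yes refl | no v≢x   = λ eq →
      i∉ψNx v a (trans (sym (ψ′-elsewhere v≢x)) (trans (sym eq) ψ′-x))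
    ... | no u≢x   | yes refl = λ eq →
      i∉ψNx u (Adj-sym a) (trans (sym (ψ′-elsewhere u≢x)) (trans eq ψ′-x))
    ... | no u≢x   | no v≢x   = λ eq →
      proper u v a (trans (sym (ψ′-elsewhere u≢x)) (trans eq (ψ′-elsewhere v≢x)))

    private
      ψx≢i : ψ x ≢ i
      ψx≢i ψx≡i = i≢ψx (sym ψx≡i)

    ψ′-x∉B : ¬ IsBVertex G ψ′ x
    ψ′-x∉B x∈B =
      let y , a , ψ′y≡ψx = x∈B (ψ x) (λ ψx≡ψ′x → ψx≢i (trans ψx≡ψ′x ψ′-x))
      in proper x y a (sym (proj₂ (ψ′-≢i ψ′y≡ψx ψx≢i)))

    ψ′-BVertex-nonadjacent : ∀ {u} → u ≢ x → ¬ Adj u x → IsBVertex G ψ′ u → IsBVertex G ψ u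
    ψ′-BVertex-nonadjacent {u} u≢x ¬ux u∈B d d≢ψu =
      let w , a , ψ′w≡d = u∈B d (λ d≡ψ′u → d≢ψu (trans d≡ψ′u (ψ′-elsewhere u≢x)))
      in w , a , trans (sym (ψ′-elsewhere (λ w≡x → ¬ux (subst (Adj u) w≡x a)))) ψ′w≡d

    ψ′-BVertex⇒OnlyMissingColor : ∀ {u} → u ≢ x → IsBVertex G ψ′ u → ¬ IsBVertex G ψ u →
                                  OnlyMissingColor ψ u x i
    ψ′-BVertex⇒OnlyMissingColor {u} u≢x u∈B′ u∉B with ¬IsBVertex⇒missingColor ψ u∉B
    ... | d , d≢ψu , d∉ψNu = onlyMissing
      where
        seenAfter : ∀ {c} → c ≢ ψ u → ∃[ w ] (Adj u w × ψ′ w ≡ c)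
        seenAfter c≢ψu = u∈B′ _ (λ c≡ψ′u → c≢ψu (trans c≡ψ′u (ψ′-elsewhere u≢x)))

        d≡i : d ≡ i
        d≡i with d ≟ i
        ... | yes d≡i = d≡i
        ... | no d≢i  = let w , a , ψ′w≡d = seenAfter d≢ψu
                        in ⊥-elim (d∉ψNu w a (proj₂ (ψ′-≢i ψ′w≡d d≢i)))

        seenBefore : ∀ c → c ≢ i → InImageClosedNbhdMinus G ψ u x c
        seenBefore c c≢i with c ≟ ψ u
        ... | yes c≡ψu = u , inj₁ refl , u≢x , sym c≡ψu
        ... | no c≢ψu  = let w , a , ψ′w≡c = seenAfter c≢ψu
                             w≢x , ψw≡c = ψ′-≢i ψ′w≡c c≢i
                         in w , inj₂ a , w≢x , ψw≡c

        i-unseen : ¬ InImageClosedNbhdMinus G ψ u x i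
        i-unseen (v , inj₁ refl , _ , ψu≡i) = d≢ψu (trans d≡i (sym ψu≡i))
        i-unseen (v , inj₂ a , _ , ψv≡i) = d∉ψNu v a (trans ψv≡i (sym d≡i))

        onlyMissing : OnlyMissingColor ψ u x i
        onlyMissing c = (λ c-unseen → decide c-unseen (c ≟ i)) , λ { refl → i-unseen }
          where
            decide : ¬ InImageClosedNbhdMinus G ψ u x c → Dec (c ≡ i) → c ≡ i
            decide _        (yes c≡i) = c≡i
            decide c-unseen (no c≢i)  = ⊥-elim (c-unseen (seenBefore c c≢i))

    ψ′-BVertex⇒BVertex : (∀ w → Adj x w → ¬ IsBVertex G ψ w → ¬ OnlyMissingColor ψ w x i) →
                         IsBVertex G ψ′ ⊆ IsBVertex G ψ
    ψ′-BVertex⇒BVertex mutable {u} u∈B′ with u ≟ x | adj? u x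
    ... | yes refl | _      = ⊥-elim (ψ′-x∉B u∈B′)
    ... | no u≢x   | no ¬ux = ψ′-BVertex-nonadjacent u≢x ¬ux u∈B′
    ... | no u≢x   | yes ux with isBVertex? G ψ u
    ...   | yes u∈B = u∈B
    ...   | no u∉B  = ⊥-elim (mutable u (Adj-sym ux) u∉B (ψ′-BVertex⇒OnlyMissingColor u≢x u∈B′ u∉B))

    BVertex⇒ψ′-BVertex : ∀ {u} → u ≢ x → ¬ InU G ψ x u → IsBVertex G ψ u → IsBVertex G ψ′ u
    BVertex⇒ψ′-BVertex {u} u≢x u∉U u∈B d d≢ψ′u
      with u∈B d (λ d≡ψu → d≢ψ′u (trans d≡ψu (sym (ψ′-elsewhere u≢x))))
    ... | w , a , ψw≡d with w ≟ x
    ...   | no w≢x = w , a , trans (ψ′-elsewhere w≢x) ψw≡d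
    ...   | yes refl with any? (λ y → adj? u y ×-dec ((ψ y ≟ ψ x) ×-dec ¬? (y ≟ x)))
    ...     | yes (y , a′ , ψy≡ψx , y≢x) = y , a′ , trans (ψ′-elsewhere y≢x) (trans ψy≡ψx ψw≡d)
    ...     | no ¬other = ⊥-elim (u∉U (u∈B , a , onlyX))
      where
        onlyX : ∀ y → Adj u y → ψ y ≡ ψ x → y ≡ x
        onlyX y a′ ψy≡ψx with y ≟ x
        ... | yes y≡x = y≡x
        ... | no y≢x  = ⊥-elim (¬other (y , a′ , ψy≡ψx , y≢x))

    InU⇒¬ψ′-BVertex : ∀ {w} → InU G ψ x w → ¬ IsBVertex G ψ′ w
    InU⇒¬ψ′-BVertex {w} (_ , wx , onlyX) w∈B′ =
      let ψx≢ψ′w = λ ψx≡ψ′w → proper w x wx (trans (sym (ψ′-elsewhere (Adj⇒≢ wx))) (sym ψx≡ψ′w))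
          y , a , ψ′y≡ψx = w∈B′ (ψ x) ψx≢ψ′w
          y≢x , ψy≡ψx = ψ′-≢i ψ′y≡ψx ψx≢i
      in y≢x (onlyX y a ψy≡ψx)

  fewerBVertices⇒classWithoutBVertex :
    ∀ {k} {ψ φ : V → Fin k} → IsMinimalBColoring G k ψ → IsColoring G k φ →
    numBVertices G φ < numBVertices G ψ →
    ∀ c → (∀ d → d ≢ c → ∃[ u ] (φ u ≡ d × IsBVertex G φ u)) →
    ∀ v → φ v ≡ c → ¬ IsBVertex G φ v
  fewerBVertices⇒classWithoutBVertex (_ , minimal) proper fewer c bVertexOf v φv≡c v∈B =
    <⇒≱ fewer (minimal _ (IsBColoring-intro proper bVertexOf′))
    where
      bVertexOf′ : ∀ d → ∃[ u ] (_ ≡ d × IsBVertex G _ u)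
      bVertexOf′ d with d ≟ c
      ... | yes refl = v , φv≡c , v∈B
      ... | no d≢c   = bVertexOf d d≢c

proposition2 : (G : Graph) (k : ℕ) (ψ : Vertex G → Fin k) (χ : ℕ)
    → IsChromaticNumber G χ
    → suc χ ≤ k
    → IsMinimalBColoring G k ψ
    → (x : Vertex G)
    → ¬ IsBVertex G ψ x
    → IsMutable G ψ x
    → ImageUSizeOne G ψ x
    → Σ (Vertex G → Fin (k ∸ 1)) (IsBColoring G (k ∸ 1))
proposition2 G zero _ _ _ _ _ _ _ _ (() , _)
proposition2 G (suc k) ψ _ _ _ minimal@((proper , classes) , _) x x∉B
             (_ , i , (i≢ψx , i∉ψNx) , mutable) (c , (w₀ , w₀∈U , _) , ψU≡c) =
  bColoring-dissolveClass G ψ′ c ψ′-proper class-c-∉B bVertexOf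
  where
    open Recolor G ψ proper x i i∉ψNx i≢ψx

    bVertexOf : ∀ d → d ≢ c → ∃[ u ] (ψ′ u ≡ d × IsBVertex G ψ′ u)
    bVertexOf d d≢c =
      let u , ψu≡d , u∈B = proj₂ (classes d)
          u≢x = λ u≡x → x∉B (subst (IsBVertex G ψ) u≡x u∈B)
          u∉U = λ u∈U → d≢c (trans (sym ψu≡d) (ψU≡c u u∈U))
      in u , trans (ψ′-elsewhere u≢x) ψu≡d , BVertex⇒ψ′-BVertex u≢x u∉U u∈B

    fewer : numBVertices G ψ′ < numBVertices G ψ
    fewer = numBVertices-< G (ψ′-BVertex⇒BVertex mutable) w₀ (proj₁ w₀∈U) (InU⇒¬ψ′-BVertex w₀∈U)

    class-c-∉B : ∀ v → ψ′ v ≡ c → ¬ IsBVertex G ψ′ v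
    class-c-∉B = fewerBVertices⇒classWithoutBVertex G minimal ψ′-proper fewer c bVertexOf
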